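{- Let $\Phi$ be an irreducible root system of rank $d\ge2$ with a set of simple roots $\Pi=\{\alpha_1,\dots,\alpha_d\}$, and let $\mathcal{S}=\Pi\cup\{ -(\alpha_1+\cdots+\alpha_d)\}$. Then $\mathcal{S}^+=\Phi$.
   Context: A set of simple roots $\Pi$ of $\Phi$ is a subset of $\Phi$ forming a basis of the ambient space such that every root is a combination of elements of $\Pi$ with all coefficients in $\mathbb{N}$ or all in $-\mathbb{N}$. For $\Psi\subseteq\Phi$, $\Psi^+=\Phi\cap\{\sum_{\alpha\in\Psi}n_\alpha\alpha:n_\alpha\in\mathbb{N}\}$. (For irreducible $\Phi$, $-(\alpha_1+\cdots+\alpha_d)$ is a root.)
   Formalization: The root system Φ lies in ℚ^d, and its inner product is a symmetric positive definite bilinear form taking rational values, rather than in a real vector space. -}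

module Defs where

-- Crystallographic root systems, realised over ℚ.
-- The ambient space is ℚ^d (as Vec ℚ d) equipped with an arbitrary
-- symmetric positive definite bilinear form given by a rational Gram matrix.

open import Data.Nat as ℕ using (ℕ; _≤_)
open import Data.Integer as ℤ using (ℤ; +_)
open import Data.Rational using (ℚ; 0ℚ; 1ℚ; _+_; _*_; -_; _<_; _/_)
open import Data.Vec using (Vec; []; _∷_; zipWith; map; replicate; foldr; lookup)
open import Data.Fin using (Fin)
open import Data.List using (List; [])
open import Data.List.Membership.Propositional using (_∈_; _∉_)
open import Data.List.Relation.Unary.All using (All)
open import Data.Product using (Σ; ∃; _×_; _,_; proj₁; proj₂)
open import Data.Sum using (_⊎_)
open import Relation.Binary.PropositionalEquality using (_≡_; _≢_)
open import Relation.Nullary using (¬_)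

V : ℕ → Set
V d = Vec ℚ d

𝟎 : ∀ {d} → V d
𝟎 = replicate _ 0ℚ

_⊕_ : ∀ {d} → V d → V d → V d
_⊕_ = zipWith _+_

_⊙_ : ∀ {d} → ℚ → V d → V d
c ⊙ v = map (c *_) v

⊖_ : ∀ {d} → V d → V d
⊖ v = map -_ v

ℕ→ℚ : ℕ → ℚ
ℕ→ℚ n = (+ n) / 1

ℤ→ℚ : ℤ → ℚ
ℤ→ℚ k = k / 1

sumℚ : ∀ {n} → Vec ℚ n → ℚ
sumℚ = foldr _ _+_ 0ℚ

vsum : ∀ {d n} → Vec (V d) n → V d
vsum = foldr _ _⊕_ 𝟎

lincomb : ∀ {d n} → Vec ℚ n → Vec (V d) n → V d
lincomb cs vs = vsum (zipWith _⊙_ cs vs)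

Bil : ∀ {d} → Vec (Vec ℚ d) d → V d → V d → ℚ
Bil G x y = sumℚ (zipWith (λ xi row → xi * sumℚ (zipWith _*_ row y)) x G)

InSpanℚ : ∀ {d} → (V d → Set) → V d → Set
InSpanℚ {d} Ψ v = Σ (List (ℚ × V d)) λ cs →
  All (λ p → Ψ (proj₂ p)) cs × v ≡ Data.List.foldr (λ p acc → (proj₁ p ⊙ proj₂ p) ⊕ acc) 𝟎 cs

InSpanℕ : ∀ {d} → (V d → Set) → V d → Set
InSpanℕ {d} Ψ v = Σ (List (ℕ × V d)) λ cs →
  All (λ p → Ψ (proj₂ p)) cs × v ≡ Data.List.foldr (λ p acc → (ℕ→ℚ (proj₁ p) ⊙ proj₂ p) ⊕ acc) 𝟎 cs

record RootSystem (d : ℕ) : Set where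
  field
    G        : Vec (Vec ℚ d) d
    Φ        : List (V d)
    G-sym    : ∀ x y → Bil G x y ≡ Bil G y x
    G-posdef : ∀ x → x ≢ 𝟎 → 0ℚ < Bil G x x
    spans    : ∀ v → InSpanℚ (_∈ Φ) v
    zero∉    : 𝟎 ∉ Φ
    reduced  : ∀ {α} c → α ∈ Φ → (c ⊙ α) ∈ Φ → c ≡ 1ℚ ⊎ c ≡ - 1ℚ
    -- s_α(β) = β - (2B(α,β)/B(α,α)) α, phrased via the integer ⟨β,α^∨⟩
    integral : ∀ {α β} → α ∈ Φ → β ∈ Φ →
               Σ ℤ λ k → ℤ→ℚ (+ 2) * Bil G α β ≡ ℤ→ℚ k * Bil G α α
    reflect  : ∀ {α β} (k : ℤ) → α ∈ Φ → β ∈ Φ →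
               ℤ→ℚ (+ 2) * Bil G α β ≡ ℤ→ℚ k * Bil G α α →
               (β ⊕ ((- ℤ→ℚ k) ⊙ α)) ∈ Φ

  B : V d → V d → ℚ
  B = Bil G

  rank : ℕ
  rank = d

  Irreducible : Set
  Irreducible = ∀ (Φ₁ Φ₂ : List (V d)) →
    (∀ x → (x ∈ Φ → x ∈ Φ₁ ⊎ x ∈ Φ₂) × (x ∈ Φ₁ ⊎ x ∈ Φ₂ → x ∈ Φ)) →
    (∀ {a b} → a ∈ Φ₁ → b ∈ Φ₂ → B a b ≡ 0ℚ) →
    Φ₁ ≡ [] ⊎ Φ₂ ≡ []

  IsSimpleRoots : Vec (V d) d → Set
  IsSimpleRoots Π =
    (∀ i → lookup Π i ∈ Φ) ×
    (∀ (c : Vec ℚ d) → lincomb c Π ≡ 𝟎 → c ≡ replicate d 0ℚ) ×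
    (∀ v → Σ (Vec ℚ d) λ c → v ≡ lincomb c Π) ×
    (∀ {β} → β ∈ Φ → Σ (Vec ℕ d) λ n →
        β ≡ lincomb (map ℕ→ℚ n) Π ⊎ β ≡ ⊖ lincomb (map ℕ→ℚ n) Π)

  _⁺ : (V d → Set) → V d → Set
  (Ψ ⁺) v = v ∈ Φ × InSpanℕ Ψ v

𝒮 : ∀ {d} → Vec (V d) d → V d → Set
𝒮 Π v = (Σ (Fin _) λ i → v ≡ lookup Π i) ⊎ v ≡ ⊖ vsum Π

-- A negative root is −Σ nᵢαᵢ with nᵢ ∈ ℕ; with N = max nᵢ it equals
-- N·(−Σαᵢ) + Σ (N − nᵢ)αᵢ, an ℕ-combination of 𝒮. A positive root already
-- is an ℕ-combination of Π ⊆ 𝒮.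
module Submission where

open import Defs
open import Data.Nat as ℕ using (ℕ; _∸_)
open import Data.Nat.Properties using (m∸n+n≡m)
open import Data.Integer as ℤ using (+_)
import Data.Integer.Properties as ℤₚ
open import Data.Rational using (ℚ; 0ℚ; _+_; _*_; -_; _-_; toℚᵘ)
open import Data.Rational.Properties
  using (_≟_; +-*-commutativeRing; toℚᵘ-injective; toℚᵘ-fromℚᵘ; toℚᵘ-homo-+)
open import Data.Rational.Unnormalised as ℚᵘ using (mkℚᵘ; *≡*)
import Data.Rational.Unnormalised.Properties as ℚᵘ
open import Data.Vec using (Vec; []; _∷_; map; toList)
open import Data.Vec.Relation.Unary.All as All using (All; []; _∷_)
import Data.Vec.Relation.Unary.All.Properties as All
open import Data.List using ([]; _∷_)
import Data.List.Relation.Unary.All as ListAll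
open import Data.List.Extrema.Nat using (max; xs≤max)
open import Data.List.Membership.Propositional using (_∈_)
open import Data.Product using (_×_; _,_; proj₁)
open import Data.Sum using (inj₁; inj₂)
open import Relation.Binary.PropositionalEquality
open import Relation.Nullary.Decidable using (dec⇒maybe)
open import Tactic.RingSolver using (solve-∀)
open import Tactic.RingSolver.Core.AlmostCommutativeRing
  using (AlmostCommutativeRing; fromCommutativeRing)

ℚ-ring : AlmostCommutativeRing _ _
ℚ-ring = fromCommutativeRing +-*-commutativeRing (λ x → dec⇒maybe (0ℚ ≟ x))

-- ℕ→ℚ k = (+ k) / 1 is definitionally fromℚᵘ (ι k), which toℚᵘ-fromℚᵘ inverts.
ℕ→ℚ-+ : ∀ m n → ℕ→ℚ (m ℕ.+ n) ≡ ℕ→ℚ m + ℕ→ℚ n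
ℕ→ℚ-+ m n = toℚᵘ-injective (begin
    toℚᵘ (ℕ→ℚ (m ℕ.+ n))            ≈⟨ toℚᵘ-fromℚᵘ (ι (m ℕ.+ n)) ⟩
    ι (m ℕ.+ n)                      ≈⟨ *≡* ℤ-sum ⟩
    ι m ℚᵘ.+ ι n                     ≈⟨ ℚᵘ.≃-sym (ℚᵘ.+-cong (toℚᵘ-fromℚᵘ (ι m)) (toℚᵘ-fromℚᵘ (ι n))) ⟩
    toℚᵘ (ℕ→ℚ m) ℚᵘ.+ toℚᵘ (ℕ→ℚ n)  ≈⟨ ℚᵘ.≃-sym (toℚᵘ-homo-+ (ℕ→ℚ m) (ℕ→ℚ n)) ⟩
    toℚᵘ (ℕ→ℚ m + ℕ→ℚ n)            ∎)
  where
    open ℚᵘ.≃-Reasoning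
    ι : ℕ → ℚᵘ.ℚᵘ
    ι k = mkℚᵘ (+ k) 0
    ℤ-sum : + (m ℕ.+ n) ℤ.* + 1 ≡ (+ m ℤ.* + 1 ℤ.+ + n ℤ.* + 1) ℤ.* + 1
    ℤ-sum rewrite ℤₚ.*-identityʳ (+ m) | ℤₚ.*-identityʳ (+ n) | ℤₚ.*-identityʳ (+ m ℤ.+ + n)
      = ℤₚ.pos-+ m n

ℕ→ℚ-∸ : ∀ {m n} → n ℕ.≤ m → ℕ→ℚ (m ∸ n) ≡ ℕ→ℚ m - ℕ→ℚ n
ℕ→ℚ-∸ {m} {n} n≤m = begin
    ℕ→ℚ (m ∸ n)                          ≡⟨ cancel (ℕ→ℚ (m ∸ n)) (ℕ→ℚ n) ⟩
    (ℕ→ℚ (m ∸ n) + ℕ→ℚ n) - ℕ→ℚ n        ≡⟨ cong (_- ℕ→ℚ n) (sym (ℕ→ℚ-+ (m ∸ n) n)) ⟩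
    ℕ→ℚ (m ∸ n ℕ.+ n) - ℕ→ℚ n            ≡⟨ cong (λ k → ℕ→ℚ k - ℕ→ℚ n) (m∸n+n≡m n≤m) ⟩
    ℕ→ℚ m - ℕ→ℚ n                        ∎
  where
    open ≡-Reasoning
    cancel : ∀ a b → a ≡ (a + b) - b
    cancel = solve-∀ ℚ-ring

map-ℕ→ℚ-∸ : ∀ {k} N (n : Vec ℕ k) → All (ℕ._≤ N) n →
            map (_-_ (ℕ→ℚ N)) (map ℕ→ℚ n) ≡ map ℕ→ℚ (map (N ∸_) n)
map-ℕ→ℚ-∸ N []      []           = refl
map-ℕ→ℚ-∸ N (x ∷ n) (x≤N ∷ n≤N) = cong₂ _∷_ (sym (ℕ→ℚ-∸ x≤N)) (map-ℕ→ℚ-∸ N n n≤N)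

⊖-⊕ : ∀ {d} (u v : V d) → ⊖ (u ⊕ v) ≡ (⊖ u) ⊕ (⊖ v)
⊖-⊕ []      []      = refl
⊖-⊕ (x ∷ u) (y ∷ v) = cong₂ _∷_ (neg-+ x y) (⊖-⊕ u v)
  where
    neg-+ : ∀ x y → - (x + y) ≡ (- x) + (- y)
    neg-+ = solve-∀ ℚ-ring

⊖𝟎≡shift : ∀ {d} q → ⊖ (𝟎 {d}) ≡ (q ⊙ (⊖ 𝟎)) ⊕ 𝟎
⊖𝟎≡shift {ℕ.zero}  q = refl
⊖𝟎≡shift {ℕ.suc d} q = cong₂ _∷_ (neg-0 q) (⊖𝟎≡shift q)
  where
    neg-0 : ∀ q → - 0ℚ ≡ q * (- 0ℚ) + 0ℚ
    neg-0 = solve-∀ ℚ-ring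

shift-step : ∀ {d} c q (a s m : V d) →
             (⊖ (c ⊙ a)) ⊕ ((q ⊙ (⊖ s)) ⊕ m) ≡ (q ⊙ (⊖ (a ⊕ s))) ⊕ (((q - c) ⊙ a) ⊕ m)
shift-step c q []      []      []      = refl
shift-step c q (a ∷ as) (s ∷ ss) (m ∷ ms) =
  cong₂ _∷_ (shift c a q s m) (shift-step c q as ss ms)
  where
    shift : ∀ c a q s m → - (c * a) + (q * (- s) + m) ≡ q * (- (a + s)) + ((q - c) * a + m)
    shift = solve-∀ ℚ-ring

⊖-lincomb≡shift : ∀ {d k} q (c : Vec ℚ k) (vs : Vec (V d) k) →
  ⊖ lincomb c vs ≡ (q ⊙ (⊖ vsum vs)) ⊕ lincomb (map (_-_ q) c) vs
⊖-lincomb≡shift q []       []       = ⊖𝟎≡shift q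
⊖-lincomb≡shift q (c ∷ cs) (a ∷ vs) = begin
    ⊖ ((c ⊙ a) ⊕ L)                                ≡⟨ ⊖-⊕ (c ⊙ a) L ⟩
    (⊖ (c ⊙ a)) ⊕ (⊖ L)                            ≡⟨ cong ((⊖ (c ⊙ a)) ⊕_) (⊖-lincomb≡shift q cs vs) ⟩
    (⊖ (c ⊙ a)) ⊕ ((q ⊙ (⊖ vsum vs)) ⊕ M)          ≡⟨ shift-step c q a (vsum vs) M ⟩
    (q ⊙ (⊖ (a ⊕ vsum vs))) ⊕ (((q - c) ⊙ a) ⊕ M)  ∎
  where
    open ≡-Reasoning
    L = lincomb cs vs
    M = lincomb (map (_-_ q) cs) vs

module _ {d : ℕ} {Ψ : V d → Set} where

  InSpanℕ-𝟎 : InSpanℕ Ψ 𝟎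
  InSpanℕ-𝟎 = [] , ListAll.[] , refl

  InSpanℕ-cons : ∀ {a v} m → Ψ a → InSpanℕ Ψ v → InSpanℕ Ψ ((ℕ→ℚ m ⊙ a) ⊕ v)
  InSpanℕ-cons m Ψa (cs , Ψcs , refl) = (m , _) ∷ cs , Ψa ListAll.∷ Ψcs , refl

  InSpanℕ-lincomb : ∀ {k} (n : Vec ℕ k) {vs : Vec (V d) k} → All Ψ vs →
                    InSpanℕ Ψ (lincomb (map ℕ→ℚ n) vs)
  InSpanℕ-lincomb []      []          = InSpanℕ-𝟎
  InSpanℕ-lincomb (x ∷ n) (Ψa ∷ Ψvs) = InSpanℕ-cons x Ψa (InSpanℕ-lincomb n Ψvs)

  InSpanℕ-⊖lincomb : ∀ {k} (n : Vec ℕ k) {vs : Vec (V d) k} → All Ψ vs → Ψ (⊖ vsum vs) →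
                     InSpanℕ Ψ (⊖ lincomb (map ℕ→ℚ n) vs)
  InSpanℕ-⊖lincomb n {vs} Ψvs Ψ⊖Σ =
    subst (InSpanℕ Ψ) (sym ⊖-lincomb≡N-shift)
      (InSpanℕ-cons N Ψ⊖Σ (InSpanℕ-lincomb (map (N ∸_) n) Ψvs))
    where
      N = max 0 (toList n)
      ⊖-lincomb≡N-shift : ⊖ lincomb (map ℕ→ℚ n) vs
                        ≡ (ℕ→ℚ N ⊙ (⊖ vsum vs)) ⊕ lincomb (map ℕ→ℚ (map (N ∸_) n)) vs
      ⊖-lincomb≡N-shift = trans (⊖-lincomb≡shift (ℕ→ℚ N) (map ℕ→ℚ n) vs)
        (cong (λ c → (ℕ→ℚ N ⊙ (⊖ vsum vs)) ⊕ lincomb c vs)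
              (map-ℕ→ℚ-∸ N n (All.toList⁻ (xs≤max 0 (toList n)))))

-- Irreducibility (and d ≥ 2) only serve in the paper to make −(α₁+⋯+α_d) a root;
-- 𝒮⁺ = Φ itself does not need them.
proposition3p9 : ∀ {d} (R : RootSystem d) → 2 ℕ.≤ d → RootSystem.Irreducible R →
    (Π : Vec (V d) d) → RootSystem.IsSimpleRoots R Π →
    ∀ v → (v ∈ RootSystem.Φ R → RootSystem._⁺ R (𝒮 Π) v) × (RootSystem._⁺ R (𝒮 Π) v → v ∈ RootSystem.Φ R)
proposition3p9 R _ _ Π (_ , _ , _ , ℕ-or-−ℕ) v = root⇒𝒮⁺ , proj₁
  where
    Π⊆𝒮 : All (𝒮 Π) Π
    Π⊆𝒮 = All.lookup⁻ (λ i → inj₁ (i , refl))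
    root⇒𝒮⁺ : v ∈ RootSystem.Φ R → RootSystem._⁺ R (𝒮 Π) v
    root⇒𝒮⁺ v∈Φ with ℕ-or-−ℕ v∈Φ
    ... | n , inj₁ refl = v∈Φ , InSpanℕ-lincomb n Π⊆𝒮
    ... | n , inj₂ refl = v∈Φ , InSpanℕ-⊖lincomb n Π⊆𝒮 (inj₂ refl)
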